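{- Let $W$ and $H$ be arbitrary finite simple graphs, let $U\subseteq V(W)$, and let $G=W(U)\sqcap H$. Then \[Z(G)\le\min\{\,Z(W)\,|V(H)|,\; Z(H)\,|U|+(|V(W)|-|U|)\,|V(H)|\,\}.\]
   Context: All graphs are finite, simple and undirected. For graphs $W,H$ and a subset $U\subseteq V(W)$ (the root set), the (generalized) hierarchical product $W(U)\sqcap H$ is the graph with vertex set $V(W)\times V(H)$ in which $(x_1,y_1)$ and $(x_2,y_2)$ are adjacent if and only if either ($x_1=x_2\in U$ and $y_1y_2\in E(H)$) or ($y_1=y_2$ and $x_1x_2\in E(W)$). Zero forcing: starting from a set $S$ of filled vertices, repeatedly apply the color change rule: if a filled vertex has exactly one unfilled neighbor, that neighbor becomes filled. $S$ is a zero forcing set if this eventually fills every vertex. The zero forcing number $Z(G)$ is the minimum size of a zero forcing set of $G$. -}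

module Defs where

open import Data.Nat using (ℕ; _*_; _+_; _∸_; _≤_; _⊔_; _⊓_)
open import Data.Fin using (Fin; remQuot)
open import Data.Fin.Subset using (Subset; _∈_; _∉_; ⊤; ∣_∣; _∪_; ⁅_⁆)
open import Data.Product using (Σ; _×_; _,_; proj₁; proj₂; ∃)
open import Data.Sum using (_⊎_)
open import Data.List using (List; []; _∷_)
open import Relation.Binary.PropositionalEquality using (_≡_)
open import Relation.Nullary using (¬_)

record Graph : Set₁ where
  field
    order : ℕ
    Adj   : Fin order → Fin order → Set
    sym   : ∀ {u v} → Adj u v → Adj v u
    irrefl : ∀ {u} → ¬ Adj u u

open Graph public

record ValidForce (G : Graph) (T : Subset (order G)) (u v : Fin (order G)) : Set where
  field
    u-filled  : u ∈ T
    v-unfilled : v ∉ T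
    adj       : Adj G u v
    unique    : ∀ w → Adj G u w → ¬ (w ≡ v) → w ∈ T

data Forces (G : Graph) : Subset (order G) → List (Fin (order G) × Fin (order G)) → Subset (order G) → Set where
  done : ∀ {T} → Forces G T [] T
  step : ∀ {T u v fs T'} → ValidForce G T u v →
         Forces G (T ∪ ⁅ v ⁆) fs T' → Forces G T ((u , v) ∷ fs) T'

IsZeroForcingSet : (G : Graph) → Subset (order G) → Set
IsZeroForcingSet G S = ∃ λ fs → Forces G S fs ⊤

IsZeroForcingNumber : Graph → ℕ → Set
IsZeroForcingNumber G k =
  (Σ (Subset (order G)) λ S → IsZeroForcingSet G S × ∣ S ∣ ≡ k)
  × (∀ S → IsZeroForcingSet G S → k ≤ ∣ S ∣)

-- Generalized hierarchical product W(U) ⊓ H.  The vertex (x , y) of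
-- V(W) × V(H) is encoded as an element of Fin (|W| * |H|) via remQuot.
data HAdj (W : Graph) (U : Subset (order W)) (H : Graph) :
          Fin (order W) × Fin (order H) → Fin (order W) × Fin (order H) → Set where
  inH : ∀ {x y₁ y₂} → x ∈ U → Adj H y₁ y₂ → HAdj W U H (x , y₁) (x , y₂)
  inW : ∀ {x₁ x₂ y} → Adj W x₁ x₂ → HAdj W U H (x₁ , y) (x₂ , y)

HAdj-sym : ∀ {W U H p q} → HAdj W U H p q → HAdj W U H q p
HAdj-sym {H = H} (inH x a) = inH x (sym H a)
HAdj-sym {W = W} (inW a) = inW (sym W a)

HAdj-irrefl : ∀ {W U H p} → ¬ HAdj W U H p p
HAdj-irrefl {H = H} (inH x a) = irrefl H a
HAdj-irrefl {W = W} (inW a) = irrefl W a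

hierProd : (W : Graph) → Subset (order W) → (H : Graph) → Graph
hierProd W U H = record
  { order = order W * order H
  ; Adj = λ i j → HAdj W U H (remQuot (order H) i) (remQuot (order H) j)
  ; sym = HAdj-sym
  ; irrefl = HAdj-irrefl
  }

-- If S is a zero forcing set of W, then S × V(H) is one of W(U) ⊓ H: a force u → v of W is
-- replayed as the forces (u , y) → (v , y), one for each y, because every other neighbour of
-- (u , y) is either some (u , y′), filled since u is, or some (w , y) with w a neighbour of u.
-- Likewise, if S is a zero forcing set of H, then (U × S) ∪ ((V(W) ∖ U) × V(H)) is one of
-- W(U) ⊓ H, replaying a force u → v of H as (x , u) → (x , v) for the roots x ∈ U; off the
-- roots the H-edges are absent, which is why those fibres start completely filled. The two
-- bounds are the sizes of these two sets.

module Submission where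

open import Defs hiding (sym)
open import Data.Nat using (ℕ; suc; _*_; _+_; _∸_; _≤_; _⊓_)
open import Data.Nat.Properties using (⊓-glb; +-assoc; +-commutativeSemigroup; *-comm; *-zeroʳ; +-identityʳ; +-∸-assoc; ≤-trans; ≤-reflexive)
open import Data.Bool using (true; false; if_then_else_)
open import Data.Fin using (Fin; combine)
open import Data.Fin.Properties using (remQuot-combine; combine-remQuot)
open import Data.Fin.Subset using (Subset; _∈_; _∉_; _⊆_; ⊤; ⊥; ∣_∣; _∪_; ⁅_⁆)
open import Data.Fin.Subset.Properties using (_∈?_; ⊆-refl; ⊆-antisym; p⊆p∪q; x∈⁅x⁆; ⊆⊤; ∈⊤; ∉⊥; x∈p∪q⁻; x∈p∪q⁺; x∈⁅y⁆⇒x≡y; ∣⊤∣≡n; ∣⊥∣≡0; ∣p∣≤n)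
open import Data.List using (List; []; _∷_; map; allFin; filter)
open import Data.List.Relation.Unary.All as All using (All; []; _∷_)
open import Data.List.Relation.Unary.All.Properties using (map⁺)
open import Data.List.Relation.Unary.Any using (here; there)
import Data.List.Membership.Propositional as List
open import Data.List.Membership.Propositional.Properties using (∈-map⁺; ∈-allFin; ∈-filter⁺; ∈-filter⁻)
open import Data.Product using (_×_; _,_; proj₂; uncurry)
open import Data.Sum using (_⊎_; inj₁; inj₂; [_,_]′)
open import Data.Vec using (Vec; []; _∷_; concat; _++_; lookup) renaming (map to mapᵥ)
open import Data.Vec.Properties using (lookup-concat; lookup-map; []=⇒lookup; lookup⇒[]=)
open import Function.Base using (id; _∘_)
open import Function.Bundles using (_⇔_; mk⇔; module Equivalence)
open Equivalence using (to; from)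
open import Relation.Binary.PropositionalEquality using (_≡_; _≢_; refl; sym; trans; cong; subst; subst₂; cong₂; module ≡-Reasoning)
open ≡-Reasoning
open import Algebra.Properties.CommutativeSemigroup +-commutativeSemigroup using (x∙yz≈y∙xz)
open import Relation.Nullary using (yes; no; contradiction)

-- Forceability, unlike validity, survives enlarging the filled set T.
record Forceable (G : Graph) (T : Subset (order G)) (u v : Fin (order G)) : Set where
  field
    filled        : u ∈ T
    adjacent      : Adj G u v
    others-filled : ∀ w → Adj G u w → w ≢ v → w ∈ T

module _ {G : Graph} where

  forceable : ∀ {T u v} → ValidForce G T u v → Forceable G T u v
  forceable vf = record
    { filled = ValidForce.u-filled vf ; adjacent = ValidForce.adj vf ; others-filled = ValidForce.unique vf }

  forceable-mono : ∀ {T S u v} → T ⊆ S → Forceable G T u v → Forceable G S u v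
  forceable-mono T⊆S f = record
    { filled = T⊆S (Forceable.filled f)
    ; adjacent = Forceable.adjacent f
    ; others-filled = λ w a w≢v → T⊆S (Forceable.others-filled f w a w≢v)
    }

  validForce : ∀ {T u v} → Forceable G T u v → v ∉ T → ValidForce G T u v
  validForce f v∉T = record
    { u-filled = Forceable.filled f ; v-unfilled = v∉T
    ; adj = Forceable.adjacent f ; unique = Forceable.others-filled f }

  ∪-⁅⁆-mono : ∀ {T S} {v : Fin (order G)} → T ⊆ S → T ∪ ⁅ v ⁆ ⊆ S ∪ ⁅ v ⁆
  ∪-⁅⁆-mono {T} {S} {v} T⊆S h with x∈p∪q⁻ T ⁅ v ⁆ h
  ... | inj₁ x∈T = x∈p∪q⁺ (inj₁ (T⊆S x∈T))
  ... | inj₂ x∈v = x∈p∪q⁺ (inj₂ x∈v)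

  ∪-⁅⁆-⊆ : ∀ {T S} {v : Fin (order G)} → T ⊆ S → v ∈ S → T ∪ ⁅ v ⁆ ⊆ S
  ∪-⁅⁆-⊆ {T} {S} {v} T⊆S v∈S h with x∈p∪q⁻ T ⁅ v ⁆ h
  ... | inj₁ x∈T = T⊆S x∈T
  ... | inj₂ x∈v = subst (_∈ S) (sym (x∈⁅y⁆⇒x≡y v x∈v)) v∈S

  -- A force whose target is already filled is skipped.
  forces-mono : ∀ {T S fs} → T ⊆ S → Forces G T fs ⊤ → IsZeroForcingSet G S
  forces-mono ⊤⊆S done = [] , subst (λ X → Forces G X [] ⊤) (sym (⊆-antisym ⊆⊤ ⊤⊆S)) done
  forces-mono {S = S} T⊆S (step {v = v} vf rest) with v ∈? S
  ... | yes v∈S = forces-mono (∪-⁅⁆-⊆ T⊆S v∈S) rest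
  ... | no v∉S with forces-mono (∪-⁅⁆-mono T⊆S) rest
  ...   | fs , S∪v = _ , step (validForce (forceable-mono T⊆S (forceable vf)) v∉S) S∪v

  zfs-mono : ∀ {T S} → T ⊆ S → IsZeroForcingSet G T → IsZeroForcingSet G S
  zfs-mono T⊆S (_ , fs) = forces-mono T⊆S fs

  zfs-force : ∀ {T u v} → Forceable G T u v →
              IsZeroForcingSet G (T ∪ ⁅ v ⁆) → IsZeroForcingSet G T
  zfs-force {T} {v = v} f zfs with v ∈? T
  ... | yes v∈T = zfs-mono (∪-⁅⁆-⊆ ⊆-refl v∈T) zfs
  ... | no v∉T with zfs
  ...   | fs , T∪v = _ , step (validForce f v∉T) T∪v

  zfs-forceAll : ∀ {T S} (fs : List (Fin (order G) × Fin (order G))) →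
                 All (uncurry (Forceable G T)) fs →
                 (∀ {i} → i ∈ S → i ∈ T ⊎ i List.∈ map proj₂ fs) →
                 IsZeroForcingSet G S → IsZeroForcingSet G T
  zfs-forceAll [] [] S⊆T zfs = zfs-mono (λ h → [ id , (λ ()) ]′ (S⊆T h)) zfs
  zfs-forceAll {T} {S} ((u , v) ∷ fs) (f ∷ fs-forceable) S⊆ zfs =
    zfs-force f (zfs-forceAll fs (All.map (forceable-mono (p⊆p∪q ⁅ v ⁆)) fs-forceable) S⊆T∪v∪fs zfs)
    where
    S⊆T∪v∪fs : ∀ {i} → i ∈ S → i ∈ T ∪ ⁅ v ⁆ ⊎ i List.∈ map proj₂ fs
    S⊆T∪v∪fs h with S⊆ h
    ... | inj₁ i∈T = inj₁ (x∈p∪q⁺ (inj₁ i∈T))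
    ... | inj₂ (here refl) = inj₁ (x∈p∪q⁺ (inj₂ (x∈⁅x⁆ v)))
    ... | inj₂ (there i∈fs) = inj₂ i∈fs

zfs-simulate : ∀ {A B : Graph} (L : Subset (order A) → Subset (order B)) → (∀ i → i ∈ L ⊤) →
               (∀ {T u v} → ValidForce A T u v →
                  IsZeroForcingSet B (L (T ∪ ⁅ v ⁆)) → IsZeroForcingSet B (L T)) →
               ∀ {S} → IsZeroForcingSet A S → IsZeroForcingSet B (L S)
zfs-simulate L L⊤-full lift-step (_ , fs) = go fs
  where
  go : ∀ {S gs} → Forces _ S gs ⊤ → IsZeroForcingSet _ (L S)
  go done = zfs-mono (λ {i} _ → L⊤-full i) ([] , done)
  go (step vf rest) = lift-step vf (go rest)

∣p++q∣ : ∀ {m n} (p : Subset m) (q : Subset n) → ∣ p ++ q ∣ ≡ ∣ p ∣ + ∣ q ∣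
∣p++q∣ []          q = refl
∣p++q∣ (true ∷ p)  q = cong suc (∣p++q∣ p q)
∣p++q∣ (false ∷ p) q = ∣p++q∣ p q

-- (S × p) ∪ ((Fin m ∖ S) × q), with the pair (x , y) stored at combine x y.
piecewise : ∀ {m k} → Subset m → Subset k → Subset k → Subset (m * k)
piecewise S p q = concat (mapᵥ (λ b → if b then p else q) S)

∣piecewise∣ : ∀ {m k} (S : Subset m) (p q : Subset k) →
              ∣ piecewise S p q ∣ ≡ ∣ S ∣ * ∣ p ∣ + (m ∸ ∣ S ∣) * ∣ q ∣
∣piecewise∣ [] p q = refl
∣piecewise∣ {suc m} (true ∷ S) p q = begin
  ∣ p ++ piecewise S p q ∣                           ≡⟨ ∣p++q∣ p _ ⟩
  ∣ p ∣ + ∣ piecewise S p q ∣                         ≡⟨ cong (∣ p ∣ +_) (∣piecewise∣ S p q) ⟩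
  ∣ p ∣ + (∣ S ∣ * ∣ p ∣ + (m ∸ ∣ S ∣) * ∣ q ∣)        ≡⟨ sym (+-assoc ∣ p ∣ _ _) ⟩
  ∣ p ∣ + ∣ S ∣ * ∣ p ∣ + (m ∸ ∣ S ∣) * ∣ q ∣          ∎
∣piecewise∣ {suc m} (false ∷ S) p q = begin
  ∣ q ++ piecewise S p q ∣                           ≡⟨ ∣p++q∣ q _ ⟩
  ∣ q ∣ + ∣ piecewise S p q ∣                         ≡⟨ cong (∣ q ∣ +_) (∣piecewise∣ S p q) ⟩
  ∣ q ∣ + (∣ S ∣ * ∣ p ∣ + (m ∸ ∣ S ∣) * ∣ q ∣)        ≡⟨ x∙yz≈y∙xz ∣ q ∣ (∣ S ∣ * ∣ p ∣) _ ⟩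
  ∣ S ∣ * ∣ p ∣ + suc (m ∸ ∣ S ∣) * ∣ q ∣             ≡⟨ cong (λ d → ∣ S ∣ * ∣ p ∣ + d * ∣ q ∣)
                                                           (sym (+-∸-assoc 1 (∣p∣≤n S))) ⟩
  ∣ S ∣ * ∣ p ∣ + (suc m ∸ ∣ S ∣) * ∣ q ∣             ∎

∈-concat : ∀ {m k} (ps : Vec (Subset k) m) {x y} → combine x y ∈ concat ps ⇔ y ∈ lookup ps x
∈-concat ps {x} {y} = mk⇔
  (λ h → lookup⇒[]= y _ (trans (sym (lookup-concat ps x y)) ([]=⇒lookup h)))
  (λ h → lookup⇒[]= _ _ (trans (lookup-concat ps x y) ([]=⇒lookup h)))

∈-piecewise : ∀ {m k} (S : Subset m) {p q : Subset k} {x y} →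
              combine x y ∈ piecewise S p q ⇔ y ∈ (if lookup S x then p else q)
∈-piecewise S {p} {q} {x} {y} =
  subst (λ r → combine x y ∈ piecewise S p q ⇔ y ∈ r)
        (lookup-map x (λ b → if b then p else q) S) (∈-concat (mapᵥ (λ b → if b then p else q) S))

∈-piecewise-∈ : ∀ {m k} {S : Subset m} {p q : Subset k} {x y} →
                x ∈ S → combine x y ∈ piecewise S p q ⇔ y ∈ p
∈-piecewise-∈ {S = S} {p} {q} {x} {y} x∈S =
  subst (λ b → combine x y ∈ piecewise S p q ⇔ y ∈ (if b then p else q))
        ([]=⇒lookup x∈S) (∈-piecewise S)

∈-piecewise-∉ : ∀ {m k} {S : Subset m} {p q : Subset k} {x y} →
                x ∉ S → combine x y ∈ piecewise S p q ⇔ y ∈ q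
∈-piecewise-∉ {S = S} {p} {q} {x} {y} x∉S =
  subst (λ b → combine x y ∈ piecewise S p q ⇔ y ∈ (if b then p else q))
        lookup≡false (∈-piecewise S)
  where
  lookup≡false : lookup S x ≡ false
  lookup≡false with lookup S x in eq
  ... | true  = contradiction (lookup⇒[]= x S eq) x∉S
  ... | false = refl

module HierarchicalProduct (W H : Graph) (U : Subset (order W)) where

  G : Graph
  G = hierProd W U H

  combine-elim : {P : Fin (order G) → Set} →
                 (∀ (x : Fin (order W)) (y : Fin (order H)) → P (combine x y)) → ∀ i → P i
  combine-elim {P} p i = subst P (combine-remQuot {order W} (order H) i) (p _ _)

  adj⁺ : ∀ {x x′ : Fin (order W)} {y y′ : Fin (order H)} →
         HAdj W U H (x , y) (x′ , y′) → Adj G (combine x y) (combine x′ y′)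
  adj⁺ {x} {x′} {y} {y′} =
    subst₂ (HAdj W U H) (sym (remQuot-combine x y)) (sym (remQuot-combine x′ y′))

  adj⁻ : ∀ {x x′ : Fin (order W)} {y y′ : Fin (order H)} →
         Adj G (combine x y) (combine x′ y′) → HAdj W U H (x , y) (x′ , y′)
  adj⁻ {x} {x′} {y} {y′} = subst₂ (HAdj W U H) (remQuot-combine x y) (remQuot-combine x′ y′)

  liftW : Subset (order W) → Subset (order G)
  liftW S = piecewise S ⊤ ⊥

  liftH : Subset (order H) → Subset (order G)
  liftH S = piecewise U S ⊤

  ∈-liftW : ∀ {S} {x : Fin (order W)} {y : Fin (order H)} → combine x y ∈ liftW S ⇔ x ∈ S
  ∈-liftW {S} {x} = mk⇔ base∈S (λ x∈S → from (∈-piecewise-∈ x∈S) ∈⊤)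
    where
    base∈S : combine x _ ∈ liftW S → x ∈ S
    base∈S h with x ∈? S
    ... | yes x∈S = x∈S
    ... | no  x∉S = contradiction (to (∈-piecewise-∉ x∉S) h) ∉⊥

  ∈-liftH : ∀ {S} {x : Fin (order W)} {y : Fin (order H)} → y ∈ S → combine x y ∈ liftH S
  ∈-liftH {x = x} y∈S with x ∈? U
  ... | yes x∈U = from (∈-piecewise-∈ x∈U) y∈S
  ... | no  x∉U = from (∈-piecewise-∉ x∉U) ∈⊤

  liftW-step : ∀ {T u v} → ValidForce W T u v →
               IsZeroForcingSet G (liftW (T ∪ ⁅ v ⁆)) → IsZeroForcingSet G (liftW T)
  liftW-step {T} {u} {v} vf =
    zfs-forceAll forces (map⁺ (All.universal forceable′ (allFin _))) covered
    where
    open ValidForce vf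
    forces : List (Fin (order G) × Fin (order G))
    forces = map (λ y → combine u y , combine v y) (allFin (order H))
    forceable′ : ∀ y → Forceable G (liftW T) (combine u y) (combine v y)
    forceable′ y = record
      { filled = from ∈-liftW u-filled
      ; adjacent = adj⁺ (inW adj)
      ; others-filled = combine-elim others
      }
      where
      others : ∀ x′ y′ → Adj G (combine u y) (combine x′ y′) → combine x′ y′ ≢ combine v y →
               combine x′ y′ ∈ liftW T
      others x′ y′ a ≢v with adj⁻ {u} {x′} {y} {y′} a
      ... | inH _ _ = from ∈-liftW u-filled
      ... | inW a′  = from ∈-liftW (unique x′ a′ (λ { refl → ≢v refl }))
    covered : ∀ {i} → i ∈ liftW (T ∪ ⁅ v ⁆) → i ∈ liftW T ⊎ i List.∈ map proj₂ forces
    covered {i} = combine-elim covered′ i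
      where
      covered′ : ∀ (x : Fin (order W)) y → combine x y ∈ liftW (T ∪ ⁅ v ⁆) →
                 combine x y ∈ liftW T ⊎ combine x y List.∈ map proj₂ forces
      covered′ x y h with x∈p∪q⁻ T ⁅ v ⁆ (to ∈-liftW h)
      ... | inj₁ x∈T = inj₁ (from ∈-liftW x∈T)
      ... | inj₂ x∈v rewrite x∈⁅y⁆⇒x≡y v x∈v = inj₂ (∈-map⁺ proj₂ (∈-map⁺ _ (∈-allFin y)))

  liftH-step : ∀ {T u v} → ValidForce H T u v →
               IsZeroForcingSet G (liftH (T ∪ ⁅ v ⁆)) → IsZeroForcingSet G (liftH T)
  liftH-step {T} {u} {v} vf =
    zfs-forceAll forces (map⁺ (All.tabulate (forceable′ ∘ ∈U))) covered
    where
    open ValidForce vf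
    rootsOfU : List (Fin (order W))
    rootsOfU = filter (_∈? U) (allFin (order W))
    ∈U : ∀ {x} → x List.∈ rootsOfU → x ∈ U
    ∈U = proj₂ ∘ ∈-filter⁻ (_∈? U) {xs = allFin (order W)}
    forces : List (Fin (order G) × Fin (order G))
    forces = map (λ x → combine x u , combine x v) rootsOfU
    forceable′ : ∀ {x} → x ∈ U → Forceable G (liftH T) (combine x u) (combine x v)
    forceable′ {x} x∈U = record
      { filled = ∈-liftH u-filled
      ; adjacent = adj⁺ (inH x∈U adj)
      ; others-filled = combine-elim others
      }
      where
      others : ∀ x′ y′ → Adj G (combine x u) (combine x′ y′) → combine x′ y′ ≢ combine x v →
               combine x′ y′ ∈ liftH T
      others x′ y′ a ≢v with adj⁻ {x} {x′} {u} {y′} a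
      ... | inH _ a′ = ∈-liftH (unique y′ a′ (λ { refl → ≢v refl }))
      ... | inW _    = ∈-liftH u-filled
    covered : ∀ {i} → i ∈ liftH (T ∪ ⁅ v ⁆) → i ∈ liftH T ⊎ i List.∈ map proj₂ forces
    covered {i} = combine-elim covered′ i
      where
      covered′ : ∀ x y → combine x y ∈ liftH (T ∪ ⁅ v ⁆) →
                 combine x y ∈ liftH T ⊎ combine x y List.∈ map proj₂ forces
      covered′ x y h with x ∈? U
      ... | no x∉U = inj₁ (from (∈-piecewise-∉ x∉U) ∈⊤)
      ... | yes x∈U with x∈p∪q⁻ T ⁅ v ⁆ (to (∈-piecewise-∈ x∈U) h)
      ...   | inj₁ y∈T = inj₁ (∈-liftH y∈T)
      ...   | inj₂ y∈v rewrite x∈⁅y⁆⇒x≡y v y∈v =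
        inj₂ (∈-map⁺ proj₂ (∈-map⁺ _ (∈-filter⁺ (_∈? U) {xs = allFin (order W)} (∈-allFin x) x∈U)))

  zfs-liftW : ∀ {S} → IsZeroForcingSet W S → IsZeroForcingSet G (liftW S)
  zfs-liftW = zfs-simulate liftW (combine-elim (λ _ _ → from ∈-liftW ∈⊤)) liftW-step

  zfs-liftH : ∀ {S} → IsZeroForcingSet H S → IsZeroForcingSet G (liftH S)
  zfs-liftH = zfs-simulate liftH (combine-elim (λ _ _ → ∈-liftH ∈⊤)) liftH-step

  ∣liftW∣ : ∀ S → ∣ liftW S ∣ ≡ ∣ S ∣ * order H
  ∣liftW∣ S = begin
    ∣ piecewise S ⊤ ⊥ ∣
      ≡⟨ ∣piecewise∣ S ⊤ ⊥ ⟩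
    ∣ S ∣ * ∣ ⊤ {order H} ∣ + (order W ∸ ∣ S ∣) * ∣ ⊥ {order H} ∣
      ≡⟨ cong₂ (λ a b → ∣ S ∣ * a + (order W ∸ ∣ S ∣) * b) (∣⊤∣≡n (order H)) (∣⊥∣≡0 (order H)) ⟩
    ∣ S ∣ * order H + (order W ∸ ∣ S ∣) * 0
      ≡⟨ cong (∣ S ∣ * order H +_) (*-zeroʳ (order W ∸ ∣ S ∣)) ⟩
    ∣ S ∣ * order H + 0
      ≡⟨ +-identityʳ _ ⟩
    ∣ S ∣ * order H
      ∎

  ∣liftH∣ : ∀ S → ∣ liftH S ∣ ≡ ∣ S ∣ * ∣ U ∣ + (order W ∸ ∣ U ∣) * order H
  ∣liftH∣ S = trans (∣piecewise∣ U S ⊤)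
    (cong₂ _+_ (*-comm ∣ U ∣ ∣ S ∣) (cong ((order W ∸ ∣ U ∣) *_) (∣⊤∣≡n (order H))))

mainTheorem11 : (W H : Graph) (U : Subset (order W)) (zW zH zG : ℕ) →
    IsZeroForcingNumber W zW → IsZeroForcingNumber H zH →
    IsZeroForcingNumber (hierProd W U H) zG →
    zG ≤ (zW * order H) ⊓ (zH * ∣ U ∣ + (order W ∸ ∣ U ∣) * order H)
mainTheorem11 W H U _ _ zG ((SW , zfsW , refl) , _) ((SH , zfsH , refl) , _) (_ , minimal) =
  ⊓-glb (bound (zfs-liftW zfsW) (∣liftW∣ SW)) (bound (zfs-liftH zfsH) (∣liftH∣ SH))
  where
  open HierarchicalProduct W H U
  bound : ∀ {S n} → IsZeroForcingSet G S → ∣ S ∣ ≡ n → zG ≤ n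
  bound zfs ∣S∣≡n = ≤-trans (minimal _ zfs) (≤-reflexive ∣S∣≡n)
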